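{- A cirquent is provable in $\mathbf{CL5}$ iff it is an instance of a binary tautology.
   Context: Formulas are built from infinitely many propositional atoms using $\neg$ (applied only to atoms; $\neg\neg F$ abbreviates $F$, and $\neg$ of a compound formula is understood via De Morgan's laws), $\wedge$ and $\vee$. A $k$-ary cirquent is a pair consisting of a pool, i.e. a sequence $\langle F_1,\ldots,F_k\rangle$ of formulas (their occurrences are called oformulas), and a structure, i.e. a finite sequence of groups, each group being a subset of $\{1,\ldots,k\}$, thought of as the set of oformulas it contains (occurrences of groups are called ogroups). A formula $F$ is identified with the cirquent with pool $\langle F\rangle$ and structure $\langle\{1\}\rangle$. A classical model assigns a truth value to each atom and extends to formulas in the standard way. A group of a cirquent is true in a model iff at least one of its oformulas is true; a cirquent is true in a model iff all of its groups are true; a cirquent is a tautology iff it is true in every model. A cirquent is binary iff no atom has more than two occurrences in it; a binary tautology is a binary cirquent that is a tautology. A substitution $\sigma$ sends each atom to a formula, extended by $\sigma(\neg P)=\neg\sigma(P)$, $\sigma(F\wedge G)=\sigma(F)\wedge\sigma(G)$, $\sigma(F\vee G)=\sigma(F)\vee\sigma(G)$, and to cirquents by applying it to every oformula; $B$ is an instance of $A$ iff $B=\sigma(A)$ for some substitution $\sigma$. $\mathbf{CL5}$ is the cirquent calculus system with the following seven rules, and a proof of a cirquent is a tree of cirquents with that cirquent at the root, each node following from its children by a rule (leaves being axioms). (Axioms) the empty cirquent (empty pool and empty structure), and the identity axiom: pool $\langle\neg F,F\rangle$, structure $\langle\{1,2\}\rangle$. (Mix) from two premises, the conclusion places one next to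 the other (concatenating pools and structures). (Exchange) swap two adjacent oformulas, correspondingly redirecting group membership, or swap two adjacent ogroups. (Weakening) add an existing oformula to an existing ogroup, or insert a new oformula anywhere in the pool (belonging to no group). (Duplication) downward: replace an ogroup by two adjacent ogroups identical to it as groups; upward: the converse. ($\vee$-introduction) merge two adjacent oformulas $F,G$ into one oformula $F\vee G$, so that an ogroup of the conclusion contains $F\vee G$ iff the corresponding ogroup of the premise contains at least one of $F,G$. ($\wedge$-introduction) the premise has adjacent oformulas $F,G$ such that no ogroup contains both, every ogroup containing $F$ is immediately followed by an ogroup containing $G$, and every ogroup containing $G$ is immediately preceded by an ogroup containing $F$; the conclusion merges each ogroup containing $F$ with the immediately following ogroup (taking the union), and then merges $F$ and $G$ into the single oformula $F\wedge G$. (The contraction rule, which merges two adjacent identical oformulas, is not included in $\mathbf{CL5}$.) -}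

module Defs where

open import Data.Nat using (ℕ; zero; suc; _+_; _≤_; _≡ᵇ_)
open import Data.Bool using (Bool; true; false; not; if_then_else_) renaming (_∧_ to _∧ᵇ_; _∨_ to _∨ᵇ_)
open import Data.Fin using (Fin; toℕ)
open import Data.List as L using (List; []; _∷_; _++_; length)
open import Data.List.Relation.Unary.All using (All)
open import Data.Vec as V using (Vec; []; _∷_; lookup; insertAt; replicate; zipWith; _[_]≔_)
open import Data.Product using (Σ; ∃; _×_; _,_)
open import Relation.Binary.PropositionalEquality using (_≡_)
open import Relation.Nullary using (¬_)

data Formula : Set where
  pos : ℕ → Formula
  neg : ℕ → Formula
  _∧_ : Formula → Formula → Formula
  _∨_ : Formula → Formula → Formula

~ : Formula → Formula
~ (pos n) = neg n
~ (neg n) = pos n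
~ (F ∧ G) = ~ F ∨ ~ G
~ (F ∨ G) = ~ F ∧ ~ G

-- A k-ary cirquent is a pool  P : Vec Formula k  together
-- with a structure  S : List (Group k); a group is a subset of the k
-- oformula positions, represented by its characteristic vector.

Group : ℕ → Set
Group k = Vec Bool k

Structure : ℕ → Set
Structure k = List (Group k)

Model : Set
Model = ℕ → Bool

eval : Model → Formula → Bool
eval M (pos n) = M n
eval M (neg n) = not (M n)
eval M (F ∧ G) = eval M F ∧ᵇ eval M G
eval M (F ∨ G) = eval M F ∨ᵇ eval M G

GroupTrue : ∀ {k} → Model → Vec Formula k → Group k → Set
GroupTrue M P g = ∃ λ i → (lookup g i ≡ true) × (eval M (lookup P i) ≡ true)

CirqTrue : ∀ {k} → Model → Vec Formula k → Structure k → Set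
CirqTrue M P S = All (GroupTrue M P) S

Tautology : ∀ {k} → Vec Formula k → Structure k → Set
Tautology P S = ∀ (M : Model) → CirqTrue M P S

occ : ℕ → Formula → ℕ
occ n (pos m) = if n ≡ᵇ m then 1 else 0
occ n (neg m) = if n ≡ᵇ m then 1 else 0
occ n (F ∧ G) = occ n F + occ n G
occ n (F ∨ G) = occ n F + occ n G

occPool : ∀ {k} → ℕ → Vec Formula k → ℕ
occPool n []       = 0
occPool n (F ∷ P)  = occ n F + occPool n P

Binary : ∀ {k} → Vec Formula k → Structure k → Set
Binary P S = ∀ (n : ℕ) → occPool n P ≤ 2

BinaryTautology : ∀ {k} → Vec Formula k → Structure k → Set
BinaryTautology P S = Binary P S × Tautology P S

Substitution : Set
Substitution = ℕ → Formula

applyF : Substitution → Formula → Formula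
applyF σ (pos n) = σ n
applyF σ (neg n) = ~ (σ n)
applyF σ (F ∧ G) = applyF σ F ∧ applyF σ G
applyF σ (F ∨ G) = applyF σ F ∨ applyF σ G

InstanceOfBinaryTautology : ∀ {k} → Vec Formula k → Structure k → Set
InstanceOfBinaryTautology {k} P' S =
  Σ (Vec Formula k) λ P → BinaryTautology P S ×
    (Σ Substitution λ σ → V.map (applyF σ) P ≡ P')

-- Positional helpers: operations at positions a and a+1 of a vector of
-- length  a + (2 + b).

swapAt : ∀ {A : Set} {b} (a : ℕ) → Vec A (a + suc (suc b)) → Vec A (a + suc (suc b))
swapAt zero    (x ∷ y ∷ v) = y ∷ x ∷ v
swapAt (suc a) (x ∷ v)     = x ∷ swapAt a v

mergeAt : ∀ {A : Set} {b} (a : ℕ) → (A → A → A) → Vec A (a + suc (suc b)) → Vec A (a + suc b)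
mergeAt zero    f (x ∷ y ∷ v) = f x y ∷ v
mergeAt (suc a) f (x ∷ v)     = x ∷ mergeAt a f v

fstAt : ∀ {A : Set} {b} (a : ℕ) → Vec A (a + suc (suc b)) → A
fstAt zero    (x ∷ y ∷ v) = x
fstAt (suc a) (x ∷ v)     = fstAt a v

sndAt : ∀ {A : Set} {b} (a : ℕ) → Vec A (a + suc (suc b)) → A
sndAt zero    (x ∷ y ∷ v) = y
sndAt (suc a) (x ∷ v)     = sndAt a v

_∪_ : ∀ {k} → Group k → Group k → Group k
_∪_ = zipWith _∨ᵇ_

-- ∧-introduction side condition (F at position a, G at position a+1)
module _ {b : ℕ} (a : ℕ) where
  private
    n = a + suc (suc b)

  HasF HasG : Group n → Set
  HasF g = fstAt a g ≡ true
  HasG g = sndAt a g ≡ true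

  AndCondition : Structure n → Set
  AndCondition S =
    (∀ (i : Fin (length S)) → ¬ (HasF (L.lookup S i) × HasG (L.lookup S i)))
    × (∀ (i : Fin (length S)) → HasF (L.lookup S i) →
         Σ (Fin (length S)) λ j → (toℕ j ≡ suc (toℕ i)) × HasG (L.lookup S j))
    × (∀ (j : Fin (length S)) → HasG (L.lookup S j) →
         Σ (Fin (length S)) λ i → (suc (toℕ i) ≡ toℕ j) × HasF (L.lookup S i))

  mergeFGroups : Structure n → Structure n
  mergeFGroups []      = []
  mergeFGroups (g ∷ S) with fstAt a g
  ... | false = g ∷ mergeFGroups S
  ... | true with S
  ...   | []      = g ∷ []
  ...   | h ∷ S'  = (g ∪ h) ∷ mergeFGroups S'

data CL5 : (k : ℕ) → Vec Formula k → Structure k → Set where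
  empty    : CL5 0 [] []
  identity : (F : Formula) → CL5 2 (~ F ∷ F ∷ []) ((true ∷ true ∷ []) ∷ [])
  mix : ∀ {k m P Q S T} → CL5 k P S → CL5 m Q T →
        CL5 (k + m) (P V.++ Q)
            (L.map (λ g → g V.++ replicate m false) S
             L.++ L.map (λ g → replicate k false V.++ g) T)
  exchangeF : ∀ {b} (a : ℕ) {P S} → CL5 (a + suc (suc b)) P S →
        CL5 (a + suc (suc b)) (swapAt a P) (L.map (swapAt a) S)
  exchangeG : ∀ {k P} (S₁ : Structure k) (g h : Group k) (S₂ : Structure k) →
        CL5 k P (S₁ ++ g ∷ h ∷ S₂) → CL5 k P (S₁ ++ h ∷ g ∷ S₂)
  weakenG : ∀ {k P} (S₁ : Structure k) (g : Group k) (S₂ : Structure k) (i : Fin k) →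
        CL5 k P (S₁ ++ g ∷ S₂) → CL5 k P (S₁ ++ (g [ i ]≔ true) ∷ S₂)
  weakenF : ∀ {k P S} (i : Fin (suc k)) (F : Formula) → CL5 k P S →
        CL5 (suc k) (insertAt P i F) (L.map (λ g → insertAt g i false) S)
  dupDown : ∀ {k P} (S₁ : Structure k) (g : Group k) (S₂ : Structure k) →
        CL5 k P (S₁ ++ g ∷ S₂) → CL5 k P (S₁ ++ g ∷ g ∷ S₂)
  dupUp : ∀ {k P} (S₁ : Structure k) (g : Group k) (S₂ : Structure k) →
        CL5 k P (S₁ ++ g ∷ g ∷ S₂) → CL5 k P (S₁ ++ g ∷ S₂)
  orIntro : ∀ {b} (a : ℕ) {P S} → CL5 (a + suc (suc b)) P S →
        CL5 (a + suc b) (mergeAt a _∨_ P) (L.map (mergeAt a _∨ᵇ_) S)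
  andIntro : ∀ {b} (a : ℕ) {P S} → AndCondition {b} a S →
        CL5 (a + suc (suc b)) P S →
        CL5 (a + suc b) (mergeAt a _∧_ P)
            (L.map (mergeAt a _∨ᵇ_) (mergeFGroups {b} a S))

{-# OPTIONS --safe #-}
module Submission where

-- Soundness carries a binary pattern along the derivation: each rule acts on the pattern as on
-- the cirquent, preserving truth and the number of occurrences of every atom.  For mix the atoms
-- of the two patterns are first renamed apart (to even and odd atoms) and the two substitutions
-- interleaved; weakening inserts a fresh atom.
--
-- Completeness: CL5 is closed under substitution, so it suffices to derive binary tautologies.
-- Read backwards, ∨-introduction gives a group containing F ∨ G both F and G, and
-- ∧-introduction splits a group containing F ∧ G into a group with F followed by one with G;
-- truth and binarity survive, so we may assume the pool consists of literals.  Then every group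
-- contains a complementary pair ¬q, q, and binarity makes it the only pair on q; such a
-- cirquent is built from copies of the identity axiom on ¬q, q mixed with a derivation for the
-- remaining pool, followed by exchanges and weakenings.

open import Defs
open import Data.Nat using (ℕ)
open import Data.Vec using (Vec)
open import Data.Product using (_×_)

open import Algebra.Bundles using (CommutativeMonoid)
import Algebra.Properties.CommutativeSemigroup as CommSemigroupProperties
open import Data.Bool using (Bool; true; false; not; if_then_else_) renaming (_∧_ to _∧ᵇ_; _∨_ to _∨ᵇ_)
import Data.Bool.Properties as Boolₚ
open import Data.Empty using (⊥-elim)
open import Data.Fin using (Fin; zero; suc)
import Data.Fin.Properties as Finₚ
open import Data.List as List using (List; []; _∷_; _++_)
import Data.List.Properties as Listₚ
open import Data.List.Relation.Binary.Permutation.Propositional as ↭ using (_↭_; ↭-sym)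
open import Data.List.Relation.Binary.Pointwise as Pointwise using (Pointwise; []; _∷_)
open import Data.List.Relation.Ternary.Interleaving using (Interleaving; []; _∷ˡ_; _∷ʳ_; break)
open import Data.List.Relation.Ternary.Interleaving.Propositional using (toPermutation)
open import Data.List.Relation.Unary.All as All using (All; []; _∷_)
import Data.List.Relation.Unary.All.Properties as Allₚ
open import Data.Nat using (zero; suc; _+_; _≤_; z≤n; s≤s; _≟_; _≡ᵇ_)
import Data.Nat.Properties as ℕₚ
open import Data.Product using (∃; _,_)
open import Data.Sum using (_⊎_; inj₁; inj₂)
import Data.Vec as Vec
open import Data.Vec using ([]; _∷_; lookup; insertAt; removeAt; replicate; _[_]≔_)
import Data.Vec.Properties as Vecₚ
import Data.Vec.Relation.Unary.All as VecAll
import Data.Vec.Relation.Unary.All.Properties as VecAllₚ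
open import Function using (_∘_; id; case_of_)
open import Function.Definitions using (Injective)
open import Relation.Binary.Construct.Closure.ReflexiveTransitive using (Star; ε; _◅_; _◅◅_; gmap)
open import Relation.Binary.PropositionalEquality
open import Relation.Nullary using (¬_; Dec; yes; no; does)
open import Relation.Nullary.Decidable using (map′; _×-dec_; dec-true; dec-false)

private
  variable
    k m n : ℕ

  open CommSemigroupProperties ℕₚ.+-commutativeSemigroup using () renaming (x∙yz≈y∙xz to +-swap)
  open CommSemigroupProperties (CommutativeMonoid.commutativeSemigroup Boolₚ.∨-commutativeMonoid)
    using () renaming (x∙yz≈y∙xz to ∨-swap; interchange to ∨-interchange)

-- Substitutions and occurrences of atoms

~-involutive : ∀ F → ~ (~ F) ≡ F
~-involutive (pos n) = refl
~-involutive (neg n) = refl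
~-involutive (F ∧ G) = cong₂ _∧_ (~-involutive F) (~-involutive G)
~-involutive (F ∨ G) = cong₂ _∨_ (~-involutive F) (~-involutive G)

applyF-~ : ∀ σ F → applyF σ (~ F) ≡ ~ (applyF σ F)
applyF-~ σ (pos n) = refl
applyF-~ σ (neg n) = sym (~-involutive (σ n))
applyF-~ σ (F ∧ G) = cong₂ _∨_ (applyF-~ σ F) (applyF-~ σ G)
applyF-~ σ (F ∨ G) = cong₂ _∧_ (applyF-~ σ F) (applyF-~ σ G)

applyF-cong : ∀ {σ τ} → (∀ n → σ n ≡ τ n) → ∀ F → applyF σ F ≡ applyF τ F
applyF-cong σ≗τ (pos n) = σ≗τ n
applyF-cong σ≗τ (neg n) = cong ~ (σ≗τ n)
applyF-cong σ≗τ (F ∧ G) = cong₂ _∧_ (applyF-cong σ≗τ F) (applyF-cong σ≗τ G)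
applyF-cong σ≗τ (F ∨ G) = cong₂ _∨_ (applyF-cong σ≗τ F) (applyF-cong σ≗τ G)

rename : (ℕ → ℕ) → Substitution
rename ρ = pos ∘ ρ

renamePool : (ℕ → ℕ) → Vec Formula k → Vec Formula k
renamePool ρ = Vec.map (applyF (rename ρ))

applyF-rename : ∀ σ ρ F → applyF σ (applyF (rename ρ) F) ≡ applyF (σ ∘ ρ) F
applyF-rename σ ρ (pos n) = refl
applyF-rename σ ρ (neg n) = refl
applyF-rename σ ρ (F ∧ G) = cong₂ _∧_ (applyF-rename σ ρ F) (applyF-rename σ ρ G)
applyF-rename σ ρ (F ∨ G) = cong₂ _∨_ (applyF-rename σ ρ F) (applyF-rename σ ρ G)

map-applyF-rename : ∀ {σ ρ τ} → (∀ n → σ (ρ n) ≡ τ n) → (P : Vec Formula k) →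
  Vec.map (applyF σ) (renamePool ρ P) ≡ Vec.map (applyF τ) P
map-applyF-rename {σ = σ} {ρ} {τ} σρ≗τ P = begin
  Vec.map (applyF σ) (renamePool ρ P)
    ≡⟨ Vecₚ.map-∘ (applyF σ) (applyF (rename ρ)) P ⟨
  Vec.map (applyF σ ∘ applyF (rename ρ)) P
    ≡⟨ Vecₚ.map-cong (λ F → trans (applyF-rename σ ρ F) (applyF-cong σρ≗τ F)) P ⟩
  Vec.map (applyF τ) P ∎
  where open ≡-Reasoning

eval-rename : ∀ M ρ F → eval M (applyF (rename ρ) F) ≡ eval (M ∘ ρ) F
eval-rename M ρ (pos n) = refl
eval-rename M ρ (neg n) = refl
eval-rename M ρ (F ∧ G) = cong₂ _∧ᵇ_ (eval-rename M ρ F) (eval-rename M ρ G)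
eval-rename M ρ (F ∨ G) = cong₂ _∨ᵇ_ (eval-rename M ρ F) (eval-rename M ρ G)

-- occ tests atoms with _≡ᵇ_, and does (m ≟ n) reduces to m ≡ᵇ n.
occ-self : ∀ q → occ q (pos q) ≡ 1
occ-self q = cong (λ b → if b then 1 else 0) (dec-true (q ≟ q) refl)

occ-~ : ∀ q F → occ q (~ F) ≡ occ q F
occ-~ q (pos n) = refl
occ-~ q (neg n) = refl
occ-~ q (F ∧ G) = cong₂ _+_ (occ-~ q F) (occ-~ q G)
occ-~ q (F ∨ G) = cong₂ _+_ (occ-~ q F) (occ-~ q G)

module _ {ρ : ℕ → ℕ} where

  occ-rename-injective : Injective _≡_ _≡_ ρ → ∀ n F → occ (ρ n) (applyF (rename ρ) F) ≡ occ n F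
  occ-rename-injective inj n (pos m) = cong (λ b → if b then 1 else 0) (≡ᵇ-injective n m)
    where
    ≡ᵇ-injective : ∀ n m → (ρ n ≡ᵇ ρ m) ≡ (n ≡ᵇ m)
    ≡ᵇ-injective n m with n ≟ m
    ... | yes refl = trans (dec-true (ρ n ≟ ρ n) refl) (sym (dec-true (n ≟ n) refl))
    ... | no n≢m   = trans (dec-false (ρ n ≟ ρ m) (n≢m ∘ inj)) (sym (dec-false (n ≟ m) n≢m))
  occ-rename-injective inj n (neg m) = occ-rename-injective inj n (pos m)
  occ-rename-injective inj n (F ∧ G) = cong₂ _+_ (occ-rename-injective inj n F) (occ-rename-injective inj n G)
  occ-rename-injective inj n (F ∨ G) = cong₂ _+_ (occ-rename-injective inj n F) (occ-rename-injective inj n G)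

  occ-rename-outside : ∀ {n} → (∀ m → ρ m ≢ n) → ∀ F → occ n (applyF (rename ρ) F) ≡ 0
  occ-rename-outside {n} ∉ρ (pos m) = cong (λ b → if b then 1 else 0) (dec-false (n ≟ ρ m) (∉ρ m ∘ sym))
  occ-rename-outside ∉ρ (neg m) = occ-rename-outside ∉ρ (pos m)
  occ-rename-outside ∉ρ (F ∧ G) = cong₂ _+_ (occ-rename-outside ∉ρ F) (occ-rename-outside ∉ρ G)
  occ-rename-outside ∉ρ (F ∨ G) = cong₂ _+_ (occ-rename-outside ∉ρ F) (occ-rename-outside ∉ρ G)

  occPool-rename-injective : Injective _≡_ _≡_ ρ → ∀ n (P : Vec Formula k) →
    occPool (ρ n) (renamePool ρ P) ≡ occPool n P
  occPool-rename-injective inj n []      = refl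
  occPool-rename-injective inj n (F ∷ P) =
    cong₂ _+_ (occ-rename-injective inj n F) (occPool-rename-injective inj n P)

  occPool-rename-outside : ∀ {n} → (∀ m → ρ m ≢ n) → (P : Vec Formula k) →
    occPool n (renamePool ρ P) ≡ 0
  occPool-rename-outside ∉ρ []      = refl
  occPool-rename-outside ∉ρ (F ∷ P) = cong₂ _+_ (occ-rename-outside ∉ρ F) (occPool-rename-outside ∉ρ P)

occPool-++ : ∀ q (P : Vec Formula k) (Q : Vec Formula m) → occPool q (P Vec.++ Q) ≡ occPool q P + occPool q Q
occPool-++ q []      Q = refl
occPool-++ q (F ∷ P) Q = trans (cong (occ q F +_) (occPool-++ q P Q)) (sym (ℕₚ.+-assoc (occ q F) _ _))

occPool-insertAt : ∀ q (P : Vec Formula k) i F → occPool q (insertAt P i F) ≡ occ q F + occPool q P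
occPool-insertAt q P       zero    F = refl
occPool-insertAt q (G ∷ P) (suc i) F =
  trans (cong (occ q G +_) (occPool-insertAt q P i F)) (+-swap (occ q G) (occ q F) (occPool q P))

occPool-swapAt : ∀ {b} q a (P : Vec Formula (a + suc (suc b))) → occPool q (swapAt a P) ≡ occPool q P
occPool-swapAt q zero    (F ∷ G ∷ P) = +-swap (occ q G) (occ q F) (occPool q P)
occPool-swapAt q (suc a) (F ∷ P)     = cong (occ q F +_) (occPool-swapAt q a P)

occPool-mergeAt : ∀ {b} q (_⊙_ : Formula → Formula → Formula) → (∀ F G → occ q (F ⊙ G) ≡ occ q F + occ q G) →
  ∀ a (P : Vec Formula (a + suc (suc b))) → occPool q (mergeAt a _⊙_ P) ≡ occPool q P
occPool-mergeAt q _⊙_ occ-⊙ zero    (F ∷ G ∷ P) =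
  trans (cong (_+ occPool q P) (occ-⊙ F G)) (ℕₚ.+-assoc (occ q F) _ _)
occPool-mergeAt q _⊙_ occ-⊙ (suc a) (F ∷ P)     = cong (occ q F +_) (occPool-mergeAt q _⊙_ occ-⊙ a P)

occ-lookup : ∀ q (P : Vec Formula k) i → occ q (lookup P i) ≤ occPool q P
occ-lookup q (F ∷ P) zero    = ℕₚ.m≤m+n _ _
occ-lookup q (F ∷ P) (suc i) = ℕₚ.≤-trans (occ-lookup q P i) (ℕₚ.m≤n+m _ _)

BinaryPool : Vec Formula k → Set
BinaryPool P = ∀ q → occPool q P ≤ 2

-- Truth of groups

∨-trueʳ : ∀ a {b} → b ≡ true → a ∨ᵇ b ≡ true
∨-trueʳ a refl = Boolₚ.∨-zeroʳ a

∨-monoʳ : ∀ a {b c} → (b ≡ true → c ≡ true) → a ∨ᵇ b ≡ true → a ∨ᵇ c ≡ true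
∨-monoʳ true  f _ = refl
∨-monoʳ false f h = f h

evalGroup : Model → Vec Formula k → Group k → Bool
evalGroup M []      []      = false
evalGroup M (F ∷ P) (c ∷ g) = (c ∧ᵇ eval M F) ∨ᵇ evalGroup M P g

evalGroup⇒GroupTrue : ∀ M (P : Vec Formula k) g → evalGroup M P g ≡ true → GroupTrue M P g
evalGroup⇒GroupTrue M [] [] ()
evalGroup⇒GroupTrue M (F ∷ P) (c ∷ g) h with c | eval M F in F-true
... | true  | true = zero , refl , F-true
... | true  | false = let i , gᵢ , Pᵢ = evalGroup⇒GroupTrue M P g h in suc i , gᵢ , Pᵢ
... | false | _     = let i , gᵢ , Pᵢ = evalGroup⇒GroupTrue M P g h in suc i , gᵢ , Pᵢ

GroupTrue⇒evalGroup : ∀ M (P : Vec Formula k) g → GroupTrue M P g → evalGroup M P g ≡ true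
GroupTrue⇒evalGroup M (F ∷ P) (c ∷ g) (zero  , refl , F-true) rewrite F-true = refl
GroupTrue⇒evalGroup M (F ∷ P) (c ∷ g) (suc i , gᵢ , Pᵢ) =
  ∨-trueʳ (c ∧ᵇ eval M F) (GroupTrue⇒evalGroup M P g (i , gᵢ , Pᵢ))

ValidGroup : Vec Formula k → Group k → Set
ValidGroup P g = ∀ M → evalGroup M P g ≡ true

Valid : Vec Formula k → Structure k → Set
Valid P = All (ValidGroup P)

tautology⇒valid : ∀ (P : Vec Formula k) S → Tautology P S → Valid P S
tautology⇒valid P []      taut = []
tautology⇒valid P (g ∷ S) taut =
  (λ M → GroupTrue⇒evalGroup M P g (All.head (taut M))) ∷ tautology⇒valid P S (λ M → All.tail (taut M))

valid⇒tautology : ∀ (P : Vec Formula k) {S} → Valid P S → Tautology P S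
valid⇒tautology P valid M = All.map (λ {g} v → evalGroup⇒GroupTrue M P g (v M)) valid

evalGroup-++ : ∀ M (P : Vec Formula k) (Q : Vec Formula m) g h →
  evalGroup M (P Vec.++ Q) (g Vec.++ h) ≡ evalGroup M P g ∨ᵇ evalGroup M Q h
evalGroup-++ M []      Q []      h = refl
evalGroup-++ M (F ∷ P) Q (c ∷ g) h =
  trans (cong ((c ∧ᵇ eval M F) ∨ᵇ_) (evalGroup-++ M P Q g h)) (sym (Boolₚ.∨-assoc (c ∧ᵇ eval M F) _ _))

evalGroup-empty : ∀ M (P : Vec Formula k) → evalGroup M P (replicate k false) ≡ false
evalGroup-empty M []      = refl
evalGroup-empty M (F ∷ P) = evalGroup-empty M P

evalGroup-∪ : ∀ M (P : Vec Formula k) g h → evalGroup M P (g ∪ h) ≡ evalGroup M P g ∨ᵇ evalGroup M P h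
evalGroup-∪ M []      []      []      = refl
evalGroup-∪ M (F ∷ P) (c ∷ g) (d ∷ h) = begin
  ((c ∨ᵇ d) ∧ᵇ e) ∨ᵇ evalGroup M P (g ∪ h)
    ≡⟨ cong₂ _∨ᵇ_ (Boolₚ.∧-distribʳ-∨ e c d) (evalGroup-∪ M P g h) ⟩
  ((c ∧ᵇ e) ∨ᵇ (d ∧ᵇ e)) ∨ᵇ (evalGroup M P g ∨ᵇ evalGroup M P h)
    ≡⟨ ∨-interchange (c ∧ᵇ e) (d ∧ᵇ e) _ _ ⟩
  ((c ∧ᵇ e) ∨ᵇ evalGroup M P g) ∨ᵇ ((d ∧ᵇ e) ∨ᵇ evalGroup M P h) ∎
  where
  e : Bool
  e = eval M F
  open ≡-Reasoning

evalGroup-insertAt : ∀ M (P : Vec Formula k) g i F c →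
  evalGroup M (insertAt P i F) (insertAt g i c) ≡ (c ∧ᵇ eval M F) ∨ᵇ evalGroup M P g
evalGroup-insertAt M P       g       zero    F c = refl
evalGroup-insertAt M (G ∷ P) (d ∷ g) (suc i) F c =
  trans (cong ((d ∧ᵇ eval M G) ∨ᵇ_) (evalGroup-insertAt M P g i F c))
        (∨-swap (d ∧ᵇ eval M G) (c ∧ᵇ eval M F) (evalGroup M P g))

evalGroup-rename : ∀ M ρ (P : Vec Formula k) g →
  evalGroup M (renamePool ρ P) g ≡ evalGroup (M ∘ ρ) P g
evalGroup-rename M ρ []      []      = refl
evalGroup-rename M ρ (F ∷ P) (c ∷ g) =
  cong₂ (λ e r → (c ∧ᵇ e) ∨ᵇ r) (eval-rename M ρ F) (evalGroup-rename M ρ P g)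

evalGroup-weaken : ∀ M (P : Vec Formula k) g i → evalGroup M P g ≡ true → evalGroup M P (g [ i ]≔ true) ≡ true
evalGroup-weaken M (F ∷ P) (true  ∷ g) zero    h = h
evalGroup-weaken M (F ∷ P) (false ∷ g) zero    h = ∨-trueʳ (eval M F) h
evalGroup-weaken M (F ∷ P) (c ∷ g)     (suc i) h = ∨-monoʳ (c ∧ᵇ eval M F) (evalGroup-weaken M P g i) h

module _ {A B : Set} (f : A → B) where

  map-swapAt : ∀ {b} a (v : Vec A (a + suc (suc b))) → Vec.map f (swapAt a v) ≡ swapAt a (Vec.map f v)
  map-swapAt zero    (x ∷ y ∷ v) = refl
  map-swapAt (suc a) (x ∷ v)     = cong (f x ∷_) (map-swapAt a v)

  map-mergeAt : ∀ {_⊙_ : A → A → A} {_⊛_ : B → B → B} → (∀ x y → f (x ⊙ y) ≡ f x ⊛ f y) →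
    ∀ {b} a (v : Vec A (a + suc (suc b))) → Vec.map f (mergeAt a _⊙_ v) ≡ mergeAt a _⊛_ (Vec.map f v)
  map-mergeAt f-hom zero    (x ∷ y ∷ v) = cong (_∷ Vec.map f v) (f-hom x y)
  map-mergeAt f-hom (suc a) (x ∷ v)     = cong (f x ∷_) (map-mergeAt f-hom a v)

evalGroup-swapAt : ∀ {b} M a (P : Vec Formula (a + suc (suc b))) g →
  evalGroup M (swapAt a P) (swapAt a g) ≡ evalGroup M P g
evalGroup-swapAt M zero    (F ∷ G ∷ P) (c ∷ d ∷ g) = ∨-swap (d ∧ᵇ eval M G) (c ∧ᵇ eval M F) (evalGroup M P g)
evalGroup-swapAt M (suc a) (F ∷ P)     (c ∷ g)     = cong ((c ∧ᵇ eval M F) ∨ᵇ_) (evalGroup-swapAt M a P g)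

evalGroup-mergeAt-∨ : ∀ {b} M a (P : Vec Formula (a + suc (suc b))) g → evalGroup M P g ≡ true →
  evalGroup M (mergeAt a _∨_ P) (mergeAt a _∨ᵇ_ g) ≡ true
evalGroup-mergeAt-∨ M zero    (F ∷ G ∷ P) (c ∷ d ∷ g) = merge c (eval M F) d (eval M G)
  where
  merge : ∀ c e d f {r} → (c ∧ᵇ e) ∨ᵇ ((d ∧ᵇ f) ∨ᵇ r) ≡ true → ((c ∨ᵇ d) ∧ᵇ (e ∨ᵇ f)) ∨ᵇ r ≡ true
  merge true  true  d     f h = refl
  merge true  false true  f h = h
  merge true  false false f h = ∨-trueʳ f h
  merge false e     false f h = h
  merge false true  true  f h = refl
  merge false false true  f h = h
evalGroup-mergeAt-∨ M (suc a) (F ∷ P)     (c ∷ g)     = ∨-monoʳ (c ∧ᵇ eval M F) (evalGroup-mergeAt-∨ M a P g)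

valid-exchangeF : ∀ {b} a {P : Vec Formula (a + suc (suc b))} {S} → Valid P S → Valid (swapAt a P) (List.map (swapAt a) S)
valid-exchangeF a {P} valid = Allₚ.map⁺ (All.map (λ {g} v M → trans (evalGroup-swapAt M a P g) (v M)) valid)

valid-orIntro : ∀ {b} a {P : Vec Formula (a + suc (suc b))} {S} → Valid P S →
  Valid (mergeAt a _∨_ P) (List.map (mergeAt a _∨ᵇ_) S)
valid-orIntro a {P} valid = Allₚ.map⁺ (All.map (λ {g} v M → evalGroup-mergeAt-∨ M a P g (v M)) valid)

evalGroup-mergeAt-neither : ∀ {b} M a (_⊙_ : Formula → Formula → Formula) (P : Vec Formula (a + suc (suc b))) g →
  fstAt a g ≡ false → sndAt a g ≡ false → evalGroup M (mergeAt a _⊙_ P) (mergeAt a _∨ᵇ_ g) ≡ evalGroup M P g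
evalGroup-mergeAt-neither M zero    _⊙_ (F ∷ G ∷ P) (false ∷ false ∷ g) refl refl = refl
evalGroup-mergeAt-neither M (suc a) _⊙_ (F ∷ P)     (c ∷ g)             g∌F  g∌G  =
  cong ((c ∧ᵇ eval M F) ∨ᵇ_) (evalGroup-mergeAt-neither M a _⊙_ P g g∌F g∌G)

evalGroup-mergeAt-pair : ∀ {b} M a (P : Vec Formula (a + suc (suc b))) g h →
  fstAt a g ≡ true → sndAt a g ≡ false → fstAt a h ≡ false → sndAt a h ≡ true →
  evalGroup M P g ≡ true → evalGroup M P h ≡ true →
  evalGroup M (mergeAt a _∧_ P) (mergeAt a _∨ᵇ_ (g ∪ h)) ≡ true
evalGroup-mergeAt-pair M zero (F ∷ G ∷ P) (true ∷ false ∷ g) (false ∷ true ∷ h) refl refl refl refl g-true h-true =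
  trans (cong ((eval M F ∧ᵇ eval M G) ∨ᵇ_) (evalGroup-∪ M P g h)) (both (eval M F) (eval M G) g-true h-true)
  where
  both : ∀ e f {r s} → e ∨ᵇ r ≡ true → f ∨ᵇ s ≡ true → (e ∧ᵇ f) ∨ᵇ (r ∨ᵇ s) ≡ true
  both true  true  _    _    = refl
  both true  false _    s≡t  = ∨-trueʳ _ s≡t
  both false f     refl _    = refl
evalGroup-mergeAt-pair M (suc a) (F ∷ P) (c ∷ g) (d ∷ h) g∋F g∌G h∌F h∋G =
  either c d (eval M F) (evalGroup-mergeAt-pair M a P g h g∋F g∌G h∌F h∋G)
  where
  either : ∀ c d e {r s t} → (r ≡ true → s ≡ true → t ≡ true) →
    (c ∧ᵇ e) ∨ᵇ r ≡ true → (d ∧ᵇ e) ∨ᵇ s ≡ true → ((c ∨ᵇ d) ∧ᵇ e) ∨ᵇ t ≡ true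
  either true  d     true  f _ _ = refl
  either true  true  false f r s = f r s
  either true  false false f r s = f r s
  either false true  true  f _ _ = refl
  either false true  false f r s = f r s
  either false false e     f r s = f r s

module _ {b : ℕ} (a : ℕ) where

  data AndBlocks : Structure (a + suc (suc b)) → Set where
    []      : AndBlocks []
    neither : ∀ {g S} → fstAt {b = b} a g ≡ false → sndAt {b = b} a g ≡ false → AndBlocks S → AndBlocks (g ∷ S)
    pair    : ∀ {g h S} → fstAt {b = b} a g ≡ true → sndAt {b = b} a g ≡ false →
              fstAt {b = b} a h ≡ false → sndAt {b = b} a h ≡ true →
              AndBlocks S → AndBlocks (g ∷ h ∷ S)

  private
    andCondition-drop : ∀ {g S} → fstAt {b = b} a g ≡ false → AndCondition {b} a (g ∷ S) → AndCondition {b} a S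
    andCondition-drop g∌F (noBoth , fThenG , gAfterF) =
        (λ i → noBoth (suc i))
      , (λ i hasF → case fThenG (suc i) hasF of λ where
           (zero  , () , _)
           (suc j , e  , hasG) → j , ℕₚ.suc-injective e , hasG)
      , (λ j hasG → case gAfterF (suc j) hasG of λ where
           (zero  , _ , hasF) → ⊥-elim (Boolₚ.not-¬ g∌F hasF)
           (suc i , e , hasF) → i , ℕₚ.suc-injective e , hasF)

    andCondition-drop₂ : ∀ {g h S} → fstAt {b = b} a h ≡ false →
      AndCondition {b} a (g ∷ h ∷ S) → AndCondition {b} a S
    andCondition-drop₂ h∌F (noBoth , fThenG , gAfterF) =
        (λ i → noBoth (suc (suc i)))
      , (λ i hasF → case fThenG (suc (suc i)) hasF of λ where
           (zero , () , _)
           (suc zero , () , _)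
           (suc (suc j) , e , hasG) → j , ℕₚ.suc-injective (ℕₚ.suc-injective e) , hasG)
      , (λ j hasG → case gAfterF (suc (suc j)) hasG of λ where
           (zero , () , _)
           (suc zero    , _ , hasF) → ⊥-elim (Boolₚ.not-¬ h∌F hasF)
           (suc (suc i) , e , hasF) → i , ℕₚ.suc-injective (ℕₚ.suc-injective e) , hasF)

  andCondition⇒andBlocks : ∀ S → AndCondition {b} a S → AndBlocks S
  andCondition⇒andBlocks []      _ = []
  andCondition⇒andBlocks (g ∷ S) c@(noBoth , fThenG , gAfterF) with fstAt {b = b} a g in g∋F | sndAt {b = b} a g in g∋G
  ... | _     | true  with _ , () , _ ← gAfterF zero g∋G
  ... | false | false = neither g∋F g∋G (andCondition⇒andBlocks S (andCondition-drop g∋F c))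
  andCondition⇒andBlocks (g ∷ [])    c@(noBoth , fThenG , gAfterF) | true | false with fThenG zero g∋F
  ... | zero , () , _
  andCondition⇒andBlocks (g ∷ h ∷ S) c@(noBoth , fThenG , gAfterF) | true | false with fThenG zero g∋F
  ... | suc zero , refl , h∋G = pair g∋F g∋G h∌F h∋G (andCondition⇒andBlocks S (andCondition-drop₂ h∌F c))
    where
    h∌F : fstAt {b = b} a h ≡ false
    h∌F = Boolₚ.¬-not (λ h∋F → noBoth (suc zero) (h∋F , h∋G))

  andBlocks⇒andCondition : ∀ {S} → AndBlocks S → AndCondition {b} a S
  andBlocks⇒andCondition [] = (λ ()) , (λ ()) , (λ ())
  andBlocks⇒andCondition (neither g∌F g∌G blocks) with andBlocks⇒andCondition blocks
  ... | noBoth , fThenG , gAfterF =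
        (λ where zero    (hasF , _) → Boolₚ.not-¬ g∌F hasF
                 (suc i)            → noBoth i)
      , (λ where zero    hasF → ⊥-elim (Boolₚ.not-¬ g∌F hasF)
                 (suc i) hasF → let j , e , hasG = fThenG i hasF in suc j , cong suc e , hasG)
      , (λ where zero    hasG → ⊥-elim (Boolₚ.not-¬ g∌G hasG)
                 (suc j) hasG → let i , e , hasF = gAfterF j hasG in suc i , cong suc e , hasF)
  andBlocks⇒andCondition (pair g∋F g∌G h∌F h∋G blocks) with andBlocks⇒andCondition blocks
  ... | noBoth , fThenG , gAfterF =
        (λ where zero          (_ , hasG) → Boolₚ.not-¬ g∌G hasG
                 (suc zero)    (hasF , _) → Boolₚ.not-¬ h∌F hasF
                 (suc (suc i))            → noBoth i)
      , (λ where zero          _    → suc zero , refl , h∋G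
                 (suc zero)    hasF → ⊥-elim (Boolₚ.not-¬ h∌F hasF)
                 (suc (suc i)) hasF → let j , e , hasG = fThenG i hasF in suc (suc j) , cong (2 +_) e , hasG)
      , (λ where zero          hasG → ⊥-elim (Boolₚ.not-¬ g∌G hasG)
                 (suc zero)    _    → zero , refl , g∋F
                 (suc (suc j)) hasG → let i , e , hasF = gAfterF j hasG in suc (suc i) , cong (2 +_) e , hasF)

  mergeFGroups-neither : ∀ {g} S → fstAt a g ≡ false → mergeFGroups {b} a (g ∷ S) ≡ g ∷ mergeFGroups {b} a S
  mergeFGroups-neither {g} S g∌F with fstAt a g
  mergeFGroups-neither S refl | .false = refl

  mergeFGroups-pair : ∀ {g} h S → fstAt a g ≡ true →
    mergeFGroups {b} a (g ∷ h ∷ S) ≡ (g ∪ h) ∷ mergeFGroups {b} a S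
  mergeFGroups-pair {g} h S g∋F with fstAt a g
  mergeFGroups-pair h S refl | .true = refl

  valid-andIntro : ∀ {P : Vec Formula (a + suc (suc b))} {S} → AndBlocks S → Valid P S →
    Valid (mergeAt a _∧_ P) (List.map (mergeAt a _∨ᵇ_) (mergeFGroups {b} a S))
  valid-andIntro [] [] = []
  valid-andIntro {P} {g ∷ S} (neither g∌F g∌G blocks) (g-valid ∷ valid)
    rewrite mergeFGroups-neither S g∌F =
    (λ M → trans (evalGroup-mergeAt-neither M a _∧_ P g g∌F g∌G) (g-valid M)) ∷ valid-andIntro blocks valid
  valid-andIntro {P} {g ∷ h ∷ S} (pair g∋F g∌G h∌F h∋G blocks) (g-valid ∷ h-valid ∷ valid)
    rewrite mergeFGroups-pair h S g∋F =
    (λ M → evalGroup-mergeAt-pair M a P g h g∋F g∌G h∌F h∋G (g-valid M) (h-valid M)) ∷ valid-andIntro blocks valid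

valid-rename : ∀ ρ (P : Vec Formula k) {S} → Valid P S → Valid (renamePool ρ P) S
valid-rename ρ P = All.map (λ {g} v M → trans (evalGroup-rename M ρ P g) (v (M ∘ ρ)))

valid-mix : ∀ (P : Vec Formula k) (Q : Vec Formula m) {S T} → Valid P S → Valid Q T →
  Valid (P Vec.++ Q) (List.map (λ g → g Vec.++ replicate m false) S ++ List.map (λ h → replicate k false Vec.++ h) T)
valid-mix P Q P-valid Q-valid = Allₚ.++⁺ (Allₚ.map⁺ (All.map left P-valid)) (Allₚ.map⁺ (All.map right Q-valid))
  where
  left : ∀ {g} → ValidGroup P g → ValidGroup (P Vec.++ Q) (g Vec.++ replicate _ false)
  left {g} v M = trans (evalGroup-++ M P Q g _) (cong₂ _∨ᵇ_ (v M) (evalGroup-empty M Q))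
  right : ∀ {h} → ValidGroup Q h → ValidGroup (P Vec.++ Q) (replicate _ false Vec.++ h)
  right {h} v M = trans (evalGroup-++ M P Q _ h) (cong₂ _∨ᵇ_ (evalGroup-empty M P) (v M))

-- Soundness

All-under : ∀ {A : Set} {Q : A → Set} S₁ {xs ys : List A} →
  (All Q xs → All Q ys) → All Q (S₁ ++ xs) → All Q (S₁ ++ ys)
All-under S₁ f all = let all₁ , all₂ = Allₚ.++⁻ S₁ all in Allₚ.++⁺ all₁ (f all₂)

structural-sound : ∀ {P : Vec Formula k} {S S′} → (∀ {Q} → Valid Q S → Valid Q S′) →
  InstanceOfBinaryTautology P S → InstanceOfBinaryTautology P S′
structural-sound f (P₀ , (binary , taut) , σ , P₀σ≡P) =
  P₀ , (binary , valid⇒tautology P₀ (f {P₀} (tautology⇒valid P₀ _ taut))) , σ , P₀σ≡P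

positional-sound : ∀ {P : Vec Formula k} {S} {S′ : Structure m} (f : Vec Formula k → Vec Formula m) →
  (∀ σ Q → Vec.map (applyF σ) (f Q) ≡ f (Vec.map (applyF σ) Q)) →
  (∀ q Q → occPool q (f Q) ≡ occPool q Q) →
  (∀ {Q} → Valid Q S → Valid (f Q) S′) →
  InstanceOfBinaryTautology P S → InstanceOfBinaryTautology (f P) S′
positional-sound f f-natural f-occ f-valid (P₀ , (binary , taut) , σ , refl) =
  f P₀ ,
  ((λ q → subst (_≤ 2) (sym (f-occ q P₀)) (binary q)) ,
   valid⇒tautology (f P₀) (f-valid {P₀} (tautology⇒valid P₀ _ taut))) ,
  σ , f-natural σ P₀

identity-sound : ∀ F → InstanceOfBinaryTautology (~ F ∷ F ∷ []) ((true ∷ true ∷ []) ∷ [])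
identity-sound F =
  neg 0 ∷ pos 0 ∷ [] ,
  (binary , valid⇒tautology (neg 0 ∷ pos 0 ∷ []) ((λ M → excludedMiddle (M 0)) ∷ [])) ,
  (λ _ → F) , refl
  where
  binary : BinaryPool (neg 0 ∷ pos 0 ∷ [])
  binary zero    = ℕₚ.≤-refl
  binary (suc q) = z≤n
  excludedMiddle : ∀ x → not x ∨ᵇ (x ∨ᵇ false) ≡ true
  excludedMiddle true  = refl
  excludedMiddle false = refl

double : ℕ → ℕ
double zero    = zero
double (suc n) = suc (suc (double n))

data Parity : ℕ → Set where
  even : ∀ n → Parity (double n)
  odd  : ∀ n → Parity (suc (double n))

parity : ∀ n → Parity n
parity zero          = even zero
parity (suc zero)    = odd zero
parity (suc (suc n)) with parity n
... | even m = even (suc m)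
... | odd m  = odd (suc m)

double-injective : Injective _≡_ _≡_ double
double-injective {zero}  {zero}  _ = refl
double-injective {suc m} {suc n} e = cong suc (double-injective (ℕₚ.suc-injective (ℕₚ.suc-injective e)))

double≢suc-double : ∀ m n → double m ≢ suc (double n)
double≢suc-double (suc m) (suc n) e = double≢suc-double m n (ℕₚ.suc-injective (ℕₚ.suc-injective e))

interleave : ∀ {A : Set} → (ℕ → A) → (ℕ → A) → ℕ → A
interleave f g zero          = f zero
interleave f g (suc zero)    = g zero
interleave f g (suc (suc n)) = interleave (f ∘ suc) (g ∘ suc) n

interleave-double : ∀ {A : Set} (f g : ℕ → A) n → interleave f g (double n) ≡ f n
interleave-double f g zero    = refl
interleave-double f g (suc n) = interleave-double (f ∘ suc) (g ∘ suc) n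

interleave-suc-double : ∀ {A : Set} (f g : ℕ → A) n → interleave f g (suc (double n)) ≡ g n
interleave-suc-double f g zero    = refl
interleave-suc-double f g (suc n) = interleave-suc-double (f ∘ suc) (g ∘ suc) n

renameApart : Vec Formula k → Vec Formula m → Vec Formula (k + m)
renameApart P Q = renamePool double P Vec.++ renamePool (suc ∘ double) Q

module _ (P : Vec Formula k) (Q : Vec Formula m) where

  occPool-renameApart-even : ∀ n → occPool (double n) (renameApart P Q) ≡ occPool n P
  occPool-renameApart-even n = begin
    occPool (double n) (renameApart P Q)
      ≡⟨ occPool-++ (double n) (renamePool double P) _ ⟩
    occPool (double n) (renamePool double P) + occPool (double n) (renamePool (suc ∘ double) Q)
      ≡⟨ cong₂ _+_ (occPool-rename-injective double-injective n P)
                   (occPool-rename-outside (λ n′ → double≢suc-double n n′ ∘ sym) Q) ⟩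
    occPool n P + 0
      ≡⟨ ℕₚ.+-identityʳ _ ⟩
    occPool n P ∎
    where open ≡-Reasoning

  occPool-renameApart-odd : ∀ n → occPool (suc (double n)) (renameApart P Q) ≡ occPool n Q
  occPool-renameApart-odd n = begin
    occPool (suc (double n)) (renameApart P Q)
      ≡⟨ occPool-++ (suc (double n)) (renamePool double P) _ ⟩
    occPool (suc (double n)) (renamePool double P) + occPool (suc (double n)) (renamePool (suc ∘ double) Q)
      ≡⟨ cong₂ _+_ (occPool-rename-outside (λ n′ → double≢suc-double n′ n) P)
                   (occPool-rename-injective (double-injective ∘ ℕₚ.suc-injective) n Q) ⟩
    occPool n Q ∎
    where open ≡-Reasoning

  binaryPool-renameApart : BinaryPool P → BinaryPool Q → BinaryPool (renameApart P Q)
  binaryPool-renameApart P-binary Q-binary n with parity n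
  ... | even n′ = subst (_≤ 2) (sym (occPool-renameApart-even n′)) (P-binary n′)
  ... | odd n′  = subst (_≤ 2) (sym (occPool-renameApart-odd n′)) (Q-binary n′)

mix-sound : ∀ {P : Vec Formula k} {Q : Vec Formula m} {S T} →
  InstanceOfBinaryTautology P S → InstanceOfBinaryTautology Q T →
  InstanceOfBinaryTautology (P Vec.++ Q)
    (List.map (λ g → g Vec.++ replicate m false) S ++ List.map (λ h → replicate k false Vec.++ h) T)
mix-sound {k} {m} {S = S} {T} (P₀ , (P₀-binary , P₀-taut) , σ , refl) (Q₀ , (Q₀-binary , Q₀-taut) , τ , refl) =
  renameApart P₀ Q₀ ,
  (binaryPool-renameApart P₀ Q₀ P₀-binary Q₀-binary , valid⇒tautology (renameApart P₀ Q₀) valid) ,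
  interleave σ τ , instantiate
  where
  valid : Valid (renameApart P₀ Q₀)
                (List.map (λ g → g Vec.++ replicate m false) S ++ List.map (λ h → replicate k false Vec.++ h) T)
  valid = valid-mix (renamePool double P₀) (renamePool (suc ∘ double) Q₀)
            (valid-rename double P₀ (tautology⇒valid P₀ _ P₀-taut))
            (valid-rename (suc ∘ double) Q₀ (tautology⇒valid Q₀ _ Q₀-taut))
  instantiate : Vec.map (applyF (interleave σ τ)) (renameApart P₀ Q₀) ≡
                Vec.map (applyF σ) P₀ Vec.++ Vec.map (applyF τ) Q₀
  instantiate =
    trans (Vecₚ.map-++ (applyF (interleave σ τ)) (renamePool double P₀) (renamePool (suc ∘ double) Q₀))
          (cong₂ Vec._++_ (map-applyF-rename {ρ = double} (interleave-double σ τ) P₀)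
                          (map-applyF-rename {ρ = suc ∘ double} (interleave-suc-double σ τ) Q₀))

weakenF-sound : ∀ {P : Vec Formula k} {S} i F → InstanceOfBinaryTautology P S →
  InstanceOfBinaryTautology (insertAt P i F) (List.map (λ g → insertAt g i false) S)
weakenF-sound {k} {S = S} i F (P₀ , (binary , taut) , σ , refl) =
  insertAt P₀′ i (pos 0) , (binary′ , valid⇒tautology (insertAt P₀′ i (pos 0)) valid′) , σ′ , instantiate
  where
  P₀′ : Vec Formula k
  P₀′ = renamePool suc P₀
  σ′ : Substitution
  σ′ zero    = F
  σ′ (suc n) = σ n
  binary′ : BinaryPool (insertAt P₀′ i (pos 0))
  binary′ q = subst (_≤ 2) (sym (occPool-insertAt q P₀′ i (pos 0))) (fresh q)
    where
    fresh : ∀ q → occ q (pos 0) + occPool q P₀′ ≤ 2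
    fresh zero    = subst (λ o → 1 + o ≤ 2) (sym (occPool-rename-outside (λ _ ()) P₀)) (s≤s z≤n)
    fresh (suc q) = subst (_≤ 2) (sym (occPool-rename-injective ℕₚ.suc-injective q P₀)) (binary q)
  valid′ : Valid (insertAt P₀′ i (pos 0)) (List.map (λ g → insertAt g i false) S)
  valid′ = Allₚ.map⁺ (All.map (λ {g} v M → trans (evalGroup-insertAt M P₀′ g i (pos 0) false) (v M))
                              (valid-rename suc P₀ (tautology⇒valid P₀ S taut)))
  instantiate : Vec.map (applyF σ′) (insertAt P₀′ i (pos 0)) ≡ insertAt (Vec.map (applyF σ) P₀) i F
  instantiate = trans (Vecₚ.map-insertAt (applyF σ′) (pos 0) P₀′ i)
                      (cong (λ Q → insertAt Q i F) (map-applyF-rename (λ _ → refl) P₀))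

mergeAt-sound : ∀ {b} a (_⊙_ : Formula → Formula → Formula) →
  (∀ σ F G → applyF σ (F ⊙ G) ≡ applyF σ F ⊙ applyF σ G) →
  (∀ q F G → occ q (F ⊙ G) ≡ occ q F + occ q G) →
  ∀ {P : Vec Formula (a + suc (suc b))} {S S′} → (∀ {Q} → Valid Q S → Valid (mergeAt a _⊙_ Q) S′) →
  InstanceOfBinaryTautology P S → InstanceOfBinaryTautology (mergeAt a _⊙_ P) S′
mergeAt-sound a _⊙_ ⊙-applyF ⊙-occ =
  positional-sound (mergeAt a _⊙_) (λ σ → map-mergeAt (applyF σ) (⊙-applyF σ) a)
                   (λ q → occPool-mergeAt q _⊙_ (⊙-occ q) a)

soundness : ∀ {P : Vec Formula k} {S} → CL5 k P S → InstanceOfBinaryTautology P S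
soundness empty                   = [] , ((λ _ → z≤n) , λ _ → []) , pos , refl
soundness (identity F)            = identity-sound F
soundness (mix d e)               = mix-sound (soundness d) (soundness e)
soundness (exchangeF a d)         =
  positional-sound (swapAt a) (λ σ → map-swapAt (applyF σ) a) (λ q → occPool-swapAt q a) (valid-exchangeF a) (soundness d)
soundness (exchangeG S₁ g h S₂ d) =
  structural-sound (All-under S₁ λ { (vg ∷ vh ∷ v) → vh ∷ vg ∷ v }) (soundness d)
soundness (weakenG S₁ g S₂ i d)   =
  structural-sound (λ {Q} → All-under S₁ λ { (vg ∷ v) → (λ M → evalGroup-weaken M Q g i (vg M)) ∷ v }) (soundness d)
soundness (weakenF i F d)         = weakenF-sound i F (soundness d)
soundness (dupDown S₁ g S₂ d)     = structural-sound (All-under S₁ λ { (vg ∷ v) → vg ∷ vg ∷ v }) (soundness d)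
soundness (dupUp S₁ g S₂ d)       = structural-sound (All-under S₁ λ { (vg ∷ _ ∷ v) → vg ∷ v }) (soundness d)
soundness (orIntro a d)           = mergeAt-sound a _∨_ (λ _ _ _ → refl) (λ _ _ _ → refl) (valid-orIntro a) (soundness d)
soundness (andIntro a c d)        =
  mergeAt-sound a _∧_ (λ _ _ _ → refl) (λ _ _ _ → refl) (valid-andIntro a (andCondition⇒andBlocks a _ c)) (soundness d)

-- Admissible rules

subst-admissible : ∀ σ {P : Vec Formula k} {S} → CL5 k P S → CL5 k (Vec.map (applyF σ) P) S
subst-admissible σ empty = empty
subst-admissible σ (identity F) =
  subst (λ Q → CL5 2 Q ((true ∷ true ∷ []) ∷ [])) (cong (_∷ applyF σ F ∷ []) (sym (applyF-~ σ F)))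
    (identity (applyF σ F))
subst-admissible σ (mix {P = P} {Q = Q} d e) =
  subst (λ R → CL5 _ R _) (sym (Vecₚ.map-++ (applyF σ) P Q)) (mix (subst-admissible σ d) (subst-admissible σ e))
subst-admissible σ (exchangeF a {P} d) =
  subst (λ R → CL5 _ R _) (sym (map-swapAt (applyF σ) a P)) (exchangeF a (subst-admissible σ d))
subst-admissible σ (exchangeG S₁ g h S₂ d) = exchangeG S₁ g h S₂ (subst-admissible σ d)
subst-admissible σ (weakenG S₁ g S₂ i d)   = weakenG S₁ g S₂ i (subst-admissible σ d)
subst-admissible σ (weakenF {P = P} i F d) =
  subst (λ R → CL5 _ R _) (sym (Vecₚ.map-insertAt (applyF σ) F P i)) (weakenF i (applyF σ F) (subst-admissible σ d))
subst-admissible σ (dupDown S₁ g S₂ d)     = dupDown S₁ g S₂ (subst-admissible σ d)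
subst-admissible σ (dupUp S₁ g S₂ d)       = dupUp S₁ g S₂ (subst-admissible σ d)
subst-admissible σ (orIntro a {P} d) =
  subst (λ R → CL5 _ R _) (sym (map-mergeAt (applyF σ) (λ _ _ → refl) a P)) (orIntro a (subst-admissible σ d))
subst-admissible σ (andIntro a {P} c d) =
  subst (λ R → CL5 _ R _) (sym (map-mergeAt (applyF σ) (λ _ _ → refl) a P)) (andIntro a c (subst-admissible σ d))

AdmissibleSuffix : Vec Formula k → Structure k → Structure k → Set
AdmissibleSuffix {k} P xs ys = ∀ S₁ → CL5 k P (S₁ ++ xs) → CL5 k P (S₁ ++ ys)

module _ {P : Vec Formula k} where

  admissibleSuffix-∷ : ∀ g {xs ys} → AdmissibleSuffix P xs ys → AdmissibleSuffix P (g ∷ xs) (g ∷ ys)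
  admissibleSuffix-∷ g {xs} {ys} rule S₁ d =
    subst (CL5 k P) (Listₚ.++-assoc S₁ (g ∷ []) ys)
      (rule (S₁ ++ g ∷ []) (subst (CL5 k P) (sym (Listₚ.++-assoc S₁ (g ∷ []) xs)) d))

  ↭-admissible : ∀ {xs ys} → xs ↭ ys → AdmissibleSuffix P xs ys
  ↭-admissible ↭.refl            S₁   = id
  ↭-admissible (↭.prep g p)      S₁   = admissibleSuffix-∷ g (↭-admissible p) S₁
  ↭-admissible (↭.swap g h p)    S₁ d =
    admissibleSuffix-∷ h (admissibleSuffix-∷ g (↭-admissible p)) S₁ (exchangeG S₁ g h _ d)
  ↭-admissible (↭.trans p q)     S₁   = ↭-admissible q S₁ ∘ ↭-admissible p S₁

AddsMember : Group k → Group k → Set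
AddsMember {k} g h = ∃ λ (i : Fin k) → h ≡ g [ i ]≔ true

_⊑_ : Group k → Group k → Set
_⊑_ = Star AddsMember

⊑-∷ : ∀ c {g h : Group k} → g ⊑ h → (c ∷ g) ⊑ (c ∷ h)
⊑-∷ c = gmap (c ∷_) (λ (i , h≡g[i]) → suc i , cong (c ∷_) h≡g[i])

false∷⊑ : ∀ c (g : Group k) → (false ∷ g) ⊑ (c ∷ g)
false∷⊑ false g = ε
false∷⊑ true  g = (zero , refl) ◅ ε

replicate-false⊑ : ∀ (g : Group k) → replicate k false ⊑ g
replicate-false⊑ []      = ε
replicate-false⊑ (c ∷ g) = ⊑-∷ false (replicate-false⊑ g) ◅◅ false∷⊑ c g

module _ {P : Vec Formula k} where

  ⊑-admissible : ∀ {g h S} → g ⊑ h → AdmissibleSuffix P (g ∷ S) (h ∷ S)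
  ⊑-admissible ε                      S₁   = id
  ⊑-admissible ((i , refl) ◅ g[i]⊑h) S₁ d = ⊑-admissible g[i]⊑h S₁ (weakenG S₁ _ _ i d)

  pointwise-⊑-admissible : ∀ {xs ys} → Pointwise _⊑_ xs ys → AdmissibleSuffix P xs ys
  pointwise-⊑-admissible []             S₁ = id
  pointwise-⊑-admissible (g⊑h ∷ xs⊑ys) S₁ =
    admissibleSuffix-∷ _ (pointwise-⊑-admissible xs⊑ys) S₁ ∘ ⊑-admissible g⊑h S₁

  interleaving-admissible : ∀ {xs ys S} → Interleaving _⊑_ _⊑_ xs ys S → CL5 k P (xs ++ ys) → CL5 k P S
  interleaving-admissible il d with break il
  ... | _ , il≡ , xs⊑ , ys⊑ =
    ↭-admissible (↭-sym (toPermutation il≡)) [] (pointwise-⊑-admissible (Pointwise.++⁺ xs⊑ ys⊑) [] d)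

data Swaps : ℕ → Set where
  []  : Swaps n
  _∷_ : ∀ {b} a → Swaps (a + suc (suc b)) → Swaps (a + suc (suc b))

permute : ∀ {A : Set} → Swaps n → Vec A n → Vec A n
permute []      v = v
permute (a ∷ s) v = permute s (swapAt a v)

swaps-admissible : ∀ (s : Swaps k) {P S} → CL5 k P S → CL5 k (permute s P) (List.map (permute s) S)
swaps-admissible []      {S = S} d = subst (CL5 _ _) (sym (Listₚ.map-id S)) d
swaps-admissible (a ∷ s) {S = S} d = subst (CL5 _ _) (sym (Listₚ.map-∘ S)) (swaps-admissible s (exchangeF a d))

lift : Swaps n → Swaps (suc n)
lift []            = []
lift (_∷_ {b} a s) = _∷_ {b = b} (suc a) (lift s)

permute-lift : ∀ {A : Set} (s : Swaps n) x (v : Vec A n) → permute (lift s) (x ∷ v) ≡ x ∷ permute s v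
permute-lift []      x v = refl
permute-lift (a ∷ s) x v = permute-lift s x (swapAt a v)

insertion : Fin (suc n) → Swaps (suc n)
insertion           zero    = []
insertion {n = suc n} (suc i) = _∷_ {b = n} 0 (lift (insertion i))

permute-insertion : ∀ {A : Set} (i : Fin (suc n)) x (v : Vec A n) → permute (insertion i) (x ∷ v) ≡ insertAt v i x
permute-insertion zero    x v       = refl
permute-insertion (suc i) x (y ∷ v) = trans (permute-lift (insertion i) y (x ∷ v)) (cong (y ∷_) (permute-insertion i x v))

pull : ∀ {A : Set} → Fin (suc n) → Vec A (suc n) → Vec A (suc n)
pull i v = lookup v i ∷ removeAt v i

permute-insertion-pull : ∀ {A : Set} (i : Fin (suc n)) (v : Vec A (suc n)) → permute (insertion i) (pull i v) ≡ v
permute-insertion-pull i v = trans (permute-insertion i (lookup v i) (removeAt v i)) (Vecₚ.insertAt-removeAt v i)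

pull-admissible : ∀ i {P : Vec Formula (suc k)} {S} → CL5 (suc k) (pull i P) (List.map (pull i) S) → CL5 (suc k) P S
pull-admissible i {P} {S} d =
  subst₂ (CL5 _) (permute-insertion-pull i P)
    (trans (sym (Listₚ.map-∘ S)) (trans (Listₚ.map-cong (permute-insertion-pull i) S) (Listₚ.map-id S)))
    (swaps-admissible (insertion i) d)

evalGroup-pull : ∀ M i (P : Vec Formula (suc k)) g → evalGroup M (pull i P) (pull i g) ≡ evalGroup M P g
evalGroup-pull M i P g =
  trans (sym (evalGroup-insertAt M (removeAt P i) (removeAt g i) i (lookup P i) (lookup g i)))
        (cong₂ (evalGroup M) (Vecₚ.insertAt-removeAt P i) (Vecₚ.insertAt-removeAt g i))

valid-pull : ∀ i (P : Vec Formula (suc k)) {S} → Valid P S → Valid (pull i P) (List.map (pull i) S)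
valid-pull i P valid = Allₚ.map⁺ (All.map (λ {g} v M → trans (evalGroup-pull M i P g) (v M)) valid)

occPool-pull : ∀ q i (P : Vec Formula (suc k)) → occPool q (pull i P) ≡ occPool q P
occPool-pull q i P =
  trans (sym (occPool-insertAt q (removeAt P i) i (lookup P i))) (cong (occPool q) (Vecₚ.insertAt-removeAt P i))

occPool-removeAt : ∀ q i (P : Vec Formula (suc k)) → occPool q (removeAt P i) ≤ occPool q P
occPool-removeAt q i P = subst (occPool q (removeAt P i) ≤_) (occPool-pull q i P) (ℕₚ.m≤n+m _ _)

-- Binary tautologies of literals

Literal : Formula → Set
Literal F = ∃ λ q → F ≡ pos q ⊎ F ≡ neg q

literal-~ : ∀ {F} → Literal F → Literal (~ F)
literal-~ (q , inj₁ refl) = q , inj₂ refl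
literal-~ (q , inj₂ refl) = q , inj₁ refl

literal-≟ : ∀ {F G} → Literal F → Literal G → Dec (F ≡ G)
literal-≟ (m , inj₁ refl) (n , inj₁ refl) = map′ (cong pos) (λ { refl → refl }) (m ≟ n)
literal-≟ (m , inj₂ refl) (n , inj₂ refl) = map′ (cong neg) (λ { refl → refl }) (m ≟ n)
literal-≟ (m , inj₁ refl) (n , inj₂ refl) = no λ ()
literal-≟ (m , inj₂ refl) (n , inj₁ refl) = no λ ()

occ-literal : ∀ {F} q → F ≡ pos q ⊎ F ≡ neg q → occ q F ≡ 1
occ-literal q (inj₁ refl) = occ-self q
occ-literal q (inj₂ refl) = occ-self q

VecAll-removeAt : ∀ {A : Set} {Q : A → Set} {v : Vec A (suc n)} → VecAll.All Q v → ∀ i →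
  VecAll.All Q (removeAt v i)
VecAll-removeAt (q VecAll.∷ qs)               zero    = qs
VecAll-removeAt (q VecAll.∷ qs@(_ VecAll.∷ _)) (suc i) = q VecAll.∷ VecAll-removeAt qs i

Complementary : Vec Formula k → Group k → Set
Complementary {k} P g = ∃ λ (i : Fin k) → ∃ λ (j : Fin k) → ∃ λ q →
  lookup g i ≡ true × lookup g j ≡ true × lookup P i ≡ neg q × lookup P j ≡ pos q

complementary⇒valid : ∀ {P : Vec Formula k} {g} → Complementary P g → ValidGroup P g
complementary⇒valid {P = P} {g} (i , j , q , gᵢ , gⱼ , Pᵢ , Pⱼ) M with M q in Mq
... | true  = GroupTrue⇒evalGroup M P g (j , gⱼ , trans (cong (eval M) Pⱼ) Mq)
... | false = GroupTrue⇒evalGroup M P g (i , gᵢ , trans (cong (eval M) Pᵢ) (cong not Mq))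

-- The falsifier makes q true iff ¬q is in g: then the negative members of g are false, so a true
-- member of g is an atom whose negation is also in g.
module _ {P : Vec Formula k} (literals : VecAll.All Literal P) (g : Group k) where

  private
    NegatedIn : ℕ → Set
    NegatedIn q = ∃ λ i → lookup g i ≡ true × lookup P i ≡ neg q

    negatedIn? : ∀ q → Dec (NegatedIn q)
    negatedIn? q = Finₚ.any? λ i →
      (lookup g i Boolₚ.≟ true) ×-dec literal-≟ (VecAllₚ.lookup⁺ literals i) (q , inj₂ refl)

    falsifier : Model
    falsifier q = does (negatedIn? q)

  valid⇒complementary : ValidGroup P g → Complementary P g
  valid⇒complementary valid = complementary (evalGroup⇒GroupTrue falsifier P g (valid falsifier))
    where
    complementary : GroupTrue falsifier P g → Complementary P g
    complementary (i , gᵢ , Pᵢ-true) with VecAllₚ.lookup⁺ literals i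
    ... | q , inj₁ Pᵢ≡pos with negatedIn? q | trans (sym (cong (eval falsifier) Pᵢ≡pos)) Pᵢ-true
    ...   | yes (i′ , gᵢ′ , Pᵢ′≡neg) | _ = i′ , i , q , gᵢ′ , gᵢ , Pᵢ′≡neg , Pᵢ≡pos
    ...   | no _                     | ()
    complementary (i , gᵢ , Pᵢ-true) | q , inj₂ Pᵢ≡neg
      with negatedIn? q | trans (sym (cong (eval falsifier) Pᵢ≡neg)) Pᵢ-true
    ...   | yes _ | ()
    ...   | no ∄  | _ = ⊥-elim (∄ (i , gᵢ , Pᵢ≡neg))

three-occurrences : ∀ {q} x (w : Vec Formula k) j → occ q x ≡ 1 → lookup w j ≡ pos q ⊎ lookup w j ≡ neg q →
  ¬ (occPool q (~ x ∷ x ∷ w) ≤ 2)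
three-occurrences {q = q} x w j x-once wⱼ binary with ℕₚ.≤-trans three≤ binary
  where
  three≤ : 3 ≤ occPool q (~ x ∷ x ∷ w)
  three≤ = ℕₚ.+-mono-≤ (ℕₚ.≤-reflexive (sym (trans (occ-~ q x) x-once)))
             (ℕₚ.+-mono-≤ (ℕₚ.≤-reflexive (sym x-once))
                          (subst (_≤ occPool q w) (occ-literal q wⱼ) (occ-lookup q w j)))
... | s≤s (s≤s ())

data IdentityOrTail {k} (w : Vec Formula k) : Group (2 + k) → Set where
  identity-pair : ∀ {r} → IdentityOrTail w (true ∷ true ∷ r)
  valid-tail    : ∀ {c d r} → ValidGroup w r → IdentityOrTail w (c ∷ d ∷ r)

-- Binarity forbids the atom of x from occurring in w, so a complementary pair either is {¬x, x} or lies in w.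
identityOrTail : ∀ x (w : Vec Formula k) {g} → BinaryPool (~ x ∷ x ∷ w) →
  Complementary (~ x ∷ x ∷ w) g → IdentityOrTail w g
identityOrTail x w {c ∷ d ∷ r} binary (zero , zero , q , _ , _ , ~x≡neg , ~x≡pos)
  with () ← trans (sym ~x≡neg) ~x≡pos
identityOrTail x w {c ∷ d ∷ r} binary (suc zero , suc zero , q , _ , _ , x≡neg , x≡pos)
  with () ← trans (sym x≡neg) x≡pos
identityOrTail x w {c ∷ d ∷ r} binary (zero , suc zero , q , refl , refl , _ , _) = identity-pair
identityOrTail x w {c ∷ d ∷ r} binary (suc zero , zero , q , refl , refl , _ , _) = identity-pair
identityOrTail x w {c ∷ d ∷ r} binary (suc (suc i) , suc (suc j) , q , rᵢ , rⱼ , wᵢ , wⱼ) =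
  valid-tail (complementary⇒valid {P = w} {g = r} (i , j , q , rᵢ , rⱼ , wᵢ , wⱼ))
identityOrTail x w {c ∷ d ∷ r} binary (zero , suc (suc j) , q , _ , _ , ~x≡neg , wⱼ≡pos) =
  ⊥-elim (three-occurrences x w j (trans (sym (occ-~ q x)) (occ-literal q (inj₂ ~x≡neg))) (inj₁ wⱼ≡pos)
                            (binary q))
identityOrTail x w {c ∷ d ∷ r} binary (suc (suc i) , zero , q , _ , _ , wᵢ≡neg , ~x≡pos) =
  ⊥-elim (three-occurrences x w i (trans (sym (occ-~ q x)) (occ-literal q (inj₁ ~x≡pos))) (inj₂ wᵢ≡neg)
                            (binary q))
identityOrTail x w {c ∷ d ∷ r} binary (suc zero , suc (suc j) , q , _ , _ , x≡neg , wⱼ≡pos) =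
  ⊥-elim (three-occurrences x w j (occ-literal q (inj₂ x≡neg)) (inj₁ wⱼ≡pos) (binary q))
identityOrTail x w {c ∷ d ∷ r} binary (suc (suc i) , suc zero , q , _ , _ , wᵢ≡neg , x≡pos) =
  ⊥-elim (three-occurrences x w i (occ-literal q (inj₁ x≡pos)) (inj₂ wᵢ≡neg) (binary q))

identity-copies : ∀ F m → CL5 2 (~ F ∷ F ∷ []) (List.replicate m (true ∷ true ∷ []))
identity-copies F zero          = weakenF zero (~ F) (weakenF zero F empty)
identity-copies F (suc zero)    = identity F
identity-copies F (suc (suc m)) = dupDown [] _ _ (identity-copies F (suc m))

identityOrTail-interleaving : ∀ {w : Vec Formula k} {S} → All (IdentityOrTail w) S →
  ∃ λ m → ∃ λ T → All (ValidGroup w) T ×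
    Interleaving _⊑_ _⊑_ (List.replicate m (true ∷ true ∷ replicate k false))
                         (List.map (λ r → false ∷ false ∷ r) T) S
identityOrTail-interleaving [] = 0 , [] , [] , []
identityOrTail-interleaving (identity-pair {r} ∷ kinds) with identityOrTail-interleaving kinds
... | m , T , T-valid , il = suc m , T , T-valid , ⊑-∷ true (⊑-∷ true (replicate-false⊑ r)) ∷ˡ il
identityOrTail-interleaving (valid-tail {c} {d} {r} r-valid ∷ kinds) with identityOrTail-interleaving kinds
... | m , T , T-valid , il =
  m , r ∷ T , r-valid ∷ T-valid , (⊑-∷ false (false∷⊑ d r) ◅◅ false∷⊑ c (d ∷ r)) ∷ʳ il

identity-mix : ∀ x (w : Vec Formula k) {S} → VecAll.All Literal (~ x ∷ x ∷ w) → BinaryPool (~ x ∷ x ∷ w) →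
  Valid (~ x ∷ x ∷ w) S → (∀ {T} → Valid w T → CL5 k w T) → CL5 (2 + k) (~ x ∷ x ∷ w) S
identity-mix {k} x w literals binary valid w-provable
  with identityOrTail-interleaving
         (All.map (λ {g} → identityOrTail x w binary ∘ valid⇒complementary literals g) valid)
... | m , T , T-valid , il = interleaving-admissible il
  (subst (λ S → CL5 (2 + k) (~ x ∷ x ∷ w) (S ++ _))
         (Listₚ.map-replicate (Vec._++ replicate k false) m (true ∷ true ∷ []))
     (mix (identity-copies x m) (w-provable T-valid)))

complement-absent : ∀ x (v : Vec Formula k) {S} → (∀ j → lookup v j ≢ ~ x) → VecAll.All Literal (x ∷ v) →
  Valid (x ∷ v) S → (∀ {T} → Valid v T → CL5 k v T) → CL5 (suc k) (x ∷ v) S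
complement-absent x v {S} ∄ literals valid v-provable =
  pointwise-⊑-admissible (weakened S) []
    (weakenF zero x (v-provable (Allₚ.map⁺ (All.map (λ {g} → tail-valid g ∘ valid⇒complementary literals g)
                                                    valid))))
  where
  tail-valid : ∀ g → Complementary (x ∷ v) g → ValidGroup v (Vec.tail g)
  tail-valid (c ∷ r) (zero , zero , q , _ , _ , x≡neg , x≡pos) with () ← trans (sym x≡neg) x≡pos
  tail-valid (c ∷ r) (zero , suc j , q , _ , _ , x≡neg , vⱼ≡pos) =
    ⊥-elim (∄ j (trans vⱼ≡pos (sym (cong ~ x≡neg))))
  tail-valid (c ∷ r) (suc i , zero , q , _ , _ , vᵢ≡neg , x≡pos) =
    ⊥-elim (∄ i (trans vᵢ≡neg (sym (cong ~ x≡pos))))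
  tail-valid (c ∷ r) (suc i , suc j , q , rᵢ , rⱼ , vᵢ , vⱼ) =
    complementary⇒valid {P = v} {g = r} (i , j , q , rᵢ , rⱼ , vᵢ , vⱼ)
  weakened : ∀ S → Pointwise _⊑_ (List.map (λ g → insertAt g zero false) (List.map Vec.tail S)) S
  weakened []            = []
  weakened ((c ∷ r) ∷ S) = false∷⊑ c r ∷ weakened S

complement-present : ∀ x (v : Vec Formula (suc k)) j {S} → lookup v j ≡ ~ x → VecAll.All Literal (x ∷ v) →
  BinaryPool (x ∷ v) → Valid (x ∷ v) S → (∀ {T} → Valid (removeAt v j) T → CL5 k (removeAt v j) T) →
  CL5 (2 + k) (x ∷ v) S
complement-present x v@(_ ∷ _) j {S} vⱼ≡~x literals@(x-literal VecAll.∷ v-literals) binary valid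
                   w-provable =
  pull-admissible (suc j) (subst (λ P → CL5 _ P (List.map (pull (suc j)) S)) (sym pulled)
    (identity-mix x (removeAt v j) literals′ binary′ valid′ w-provable))
  where
  pulled : pull (suc j) (x ∷ v) ≡ ~ x ∷ x ∷ removeAt v j
  pulled = cong (_∷ x ∷ removeAt v j) vⱼ≡~x
  literals′ : VecAll.All Literal (~ x ∷ x ∷ removeAt v j)
  literals′ = literal-~ x-literal VecAll.∷ x-literal VecAll.∷ VecAll-removeAt v-literals j
  binary′ : BinaryPool (~ x ∷ x ∷ removeAt v j)
  binary′ q = subst (λ P → occPool q P ≤ 2) pulled
                    (subst (_≤ 2) (sym (occPool-pull q (suc j) (x ∷ v))) (binary q))
  valid′ : Valid (~ x ∷ x ∷ removeAt v j) (List.map (pull (suc j)) S)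
  valid′ = subst (λ P → Valid P (List.map (pull (suc j)) S)) pulled (valid-pull (suc j) (x ∷ v) valid)

-- The induction hypotheses are arguments so that literal-provable recurses structurally on the pool length.
literal-provable-∷ : ∀ x (v : Vec Formula (suc k)) {S} →
  VecAll.All Literal (x ∷ v) → BinaryPool (x ∷ v) → Valid (x ∷ v) S →
  (∀ {T} → Valid v T → CL5 (suc k) v T) → (∀ j {T} → Valid (removeAt v j) T → CL5 k (removeAt v j) T) →
  CL5 (2 + k) (x ∷ v) S
literal-provable-∷ x v literals@(x-literal VecAll.∷ v-literals) binary valid v-provable w-provable
  with Finₚ.any? (λ j → literal-≟ (VecAllₚ.lookup⁺ v-literals j) (literal-~ x-literal))
... | no ∄            = complement-absent x v (λ j vⱼ≡~x → ∄ (j , vⱼ≡~x)) literals valid v-provable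
... | yes (j , vⱼ≡~x) = complement-present x v j vⱼ≡~x literals binary valid (w-provable j)

literal-provable : ∀ k (P : Vec Formula k) {S} → VecAll.All Literal P → BinaryPool P → Valid P S → CL5 k P S
literal-provable zero          []       {[]}     _ _ _           = empty
literal-provable zero          []       {[] ∷ S} _ _ (valid ∷ _) with () ← valid (λ _ → true)
literal-provable (suc zero)    (x ∷ []) literals _ valid =
  complement-absent x [] (λ ()) literals valid (literal-provable zero [] VecAll.[] (λ _ → z≤n))
literal-provable (suc (suc k)) (x ∷ v)  literals@(_ VecAll.∷ v-literals) binary valid =
  literal-provable-∷ x v literals binary valid
    (literal-provable (suc k) v v-literals (λ q → ℕₚ.≤-trans (ℕₚ.m≤n+m _ (occ q x)) (binary q)))
    (λ j → literal-provable k (removeAt v j) (VecAll-removeAt v-literals j)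
             (λ q → ℕₚ.≤-trans (ℕₚ.≤-trans (occPool-removeAt q j v) (ℕₚ.m≤n+m _ (occ q x))) (binary q)))

-- Removing connectives

elemAt : ∀ {A : Set} {b} a → Vec A (a + suc b) → A
elemAt zero    (x ∷ _) = x
elemAt (suc a) (_ ∷ v) = elemAt a v

replaceByPair : ∀ {A : Set} {b} a → A → A → Vec A (a + suc b) → Vec A (a + suc (suc b))
replaceByPair zero    u w (_ ∷ v) = u ∷ w ∷ v
replaceByPair (suc a) u w (x ∷ v) = x ∷ replaceByPair a u w v

module _ {A : Set} {b : ℕ} where

  fstAt-replaceByPair : ∀ a (u w : A) (v : Vec A (a + suc b)) → fstAt a (replaceByPair a u w v) ≡ u
  fstAt-replaceByPair zero    u w (_ ∷ v) = refl
  fstAt-replaceByPair (suc a) u w (_ ∷ v) = fstAt-replaceByPair a u w v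

  sndAt-replaceByPair : ∀ a (u w : A) (v : Vec A (a + suc b)) → sndAt a (replaceByPair a u w v) ≡ w
  sndAt-replaceByPair zero    u w (_ ∷ v) = refl
  sndAt-replaceByPair (suc a) u w (_ ∷ v) = sndAt-replaceByPair a u w v

mergeAt-replaceByPair : ∀ {b} a u w (g : Group (a + suc b)) → u ∨ᵇ w ≡ elemAt a g →
  mergeAt a _∨ᵇ_ (replaceByPair a u w g) ≡ g
mergeAt-replaceByPair zero    u w (c ∷ g) u∨w≡c = cong (_∷ g) u∨w≡c
mergeAt-replaceByPair (suc a) u w (c ∷ g) u∨w≡c = cong (c ∷_) (mergeAt-replaceByPair a u w g u∨w≡c)

replaceByPair-∪ : ∀ {b} a u w u′ w′ (g : Group (a + suc b)) →
  replaceByPair a u w g ∪ replaceByPair a u′ w′ g ≡ replaceByPair a (u ∨ᵇ u′) (w ∨ᵇ w′) g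
replaceByPair-∪ zero    u w u′ w′ (c ∷ g) =
  cong ((u ∨ᵇ u′) ∷_) (cong ((w ∨ᵇ w′) ∷_) (Vecₚ.zipWith-idem Boolₚ.∨-idem g))
replaceByPair-∪ (suc a) u w u′ w′ (c ∷ g) = cong₂ _∷_ (Boolₚ.∨-idem c) (replaceByPair-∪ a u w u′ w′ g)

evalGroup-replaceByPair : ∀ {b} M a (_⊙_ : Formula → Formula → Formula) (P : Vec Formula (a + suc (suc b))) u w g →
  (elemAt a g ∧ᵇ eval M (fstAt a P ⊙ sndAt a P) ≡ true →
     (u ∧ᵇ eval M (fstAt a P)) ∨ᵇ (w ∧ᵇ eval M (sndAt a P)) ≡ true) →
  evalGroup M (mergeAt a _⊙_ P) g ≡ true → evalGroup M P (replaceByPair a u w g) ≡ true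
evalGroup-replaceByPair M zero _⊙_ (F ∷ G ∷ P) u w (c ∷ g) local g-true with c ∧ᵇ eval M (F ⊙ G)
... | true  = trans (sym (Boolₚ.∨-assoc (u ∧ᵇ eval M F) _ _)) (cong (_∨ᵇ evalGroup M P g) (local refl))
... | false = ∨-trueʳ (u ∧ᵇ eval M F) (∨-trueʳ (w ∧ᵇ eval M G) g-true)
evalGroup-replaceByPair M (suc a) _⊙_ (F ∷ P) u w (c ∷ g) local =
  ∨-monoʳ (c ∧ᵇ eval M F) (evalGroup-replaceByPair M a _⊙_ P u w g local)

module _ {b : ℕ} (a : ℕ) where

  splitOr : Group (a + suc b) → Group (a + suc (suc b))
  splitOr g = replaceByPair a (elemAt a g) (elemAt a g) g

  valid-splitOr : ∀ (P : Vec Formula (a + suc (suc b))) {S} → Valid (mergeAt a _∨_ P) S → Valid P (List.map splitOr S)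
  valid-splitOr P valid = Allₚ.map⁺ (All.map (λ {g} v M →
    evalGroup-replaceByPair M a _∨_ P _ _ g (trans (sym (Boolₚ.∧-distribˡ-∨ (elemAt a g) _ _))) (v M)) valid)

  mergeAt-splitOr : ∀ S → List.map (mergeAt a _∨ᵇ_) (List.map splitOr S) ≡ S
  mergeAt-splitOr S = begin
    List.map (mergeAt a _∨ᵇ_) (List.map splitOr S) ≡⟨ Listₚ.map-∘ S ⟨
    List.map (mergeAt a _∨ᵇ_ ∘ splitOr) S
      ≡⟨ Listₚ.map-cong (λ g → mergeAt-replaceByPair a _ _ g (Boolₚ.∨-idem _)) S ⟩
    List.map id S                                  ≡⟨ Listₚ.map-id S ⟩
    S                                              ∎
    where open ≡-Reasoning

  splitAndGroup : Bool → Group (a + suc b) → Structure (a + suc (suc b))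
  splitAndGroup true  g = replaceByPair a true false g ∷ replaceByPair a false true g ∷ []
  splitAndGroup false g = replaceByPair a false false g ∷ []

  splitAnd : Structure (a + suc b) → Structure (a + suc (suc b))
  splitAnd []      = []
  splitAnd (g ∷ S) = splitAndGroup (elemAt a g) g ++ splitAnd S

  andBlocks-splitAnd : ∀ S → AndBlocks a (splitAnd S)
  andBlocks-splitAnd []      = []
  andBlocks-splitAnd (g ∷ S) with elemAt a g
  ... | true  = pair (fstAt-replaceByPair a true false g) (sndAt-replaceByPair a true false g)
                     (fstAt-replaceByPair a false true g) (sndAt-replaceByPair a false true g) (andBlocks-splitAnd S)
  ... | false = neither (fstAt-replaceByPair a false false g) (sndAt-replaceByPair a false false g) (andBlocks-splitAnd S)

  mergeFGroups-splitAnd : ∀ S → List.map (mergeAt a _∨ᵇ_) (mergeFGroups {b} a (splitAnd S)) ≡ S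
  mergeFGroups-splitAnd []      = refl
  mergeFGroups-splitAnd (g ∷ S) with elemAt a g in g∋F∧G
  ... | true  rewrite mergeFGroups-pair a (replaceByPair a false true g) (splitAnd S) (fstAt-replaceByPair a true false g)
                    | replaceByPair-∪ a true false false true g =
    cong₂ _∷_ (mergeAt-replaceByPair a true true g (sym g∋F∧G)) (mergeFGroups-splitAnd S)
  ... | false rewrite mergeFGroups-neither a (splitAnd S) (fstAt-replaceByPair a false false g) =
    cong₂ _∷_ (mergeAt-replaceByPair a false false g (sym g∋F∧G)) (mergeFGroups-splitAnd S)

  valid-splitAnd : ∀ (P : Vec Formula (a + suc (suc b))) {S} → Valid (mergeAt a _∧_ P) S → Valid P (splitAnd S)
  valid-splitAnd P []                  = []
  valid-splitAnd P {g ∷ S} (v ∷ valid) with elemAt a g in g∋F∧G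
  ... | true  = (λ M → evalGroup-replaceByPair M a _∧_ P true false g (left (eval M (fstAt a P)) g∋F∧G) (v M))
              ∷ (λ M → evalGroup-replaceByPair M a _∧_ P false true g (right (eval M (fstAt a P)) g∋F∧G) (v M))
              ∷ valid-splitAnd P valid
    where
    left : ∀ {c} e {f} → c ≡ true → c ∧ᵇ (e ∧ᵇ f) ≡ true → (true ∧ᵇ e) ∨ᵇ (false ∧ᵇ f) ≡ true
    left true  refl _ = refl
    left false refl ()
    right : ∀ {c} e {f} → c ≡ true → c ∧ᵇ (e ∧ᵇ f) ≡ true → (false ∧ᵇ e) ∨ᵇ (true ∧ᵇ f) ≡ true
    right true  refl f-true = f-true
    right false refl ()
  ... | false = (λ M → evalGroup-replaceByPair M a _∧_ P false false g (absurd g∋F∧G) (v M)) ∷ valid-splitAnd P valid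
    where
    absurd : ∀ {c e} {A : Set} → c ≡ false → c ∧ᵇ e ≡ true → A
    absurd refl ()

connectives : Formula → ℕ
connectives (pos _) = 0
connectives (neg _) = 0
connectives (F ∧ G) = suc (connectives F + connectives G)
connectives (F ∨ G) = suc (connectives F + connectives G)

size : Vec Formula k → ℕ
size []      = 0
size (F ∷ P) = connectives F + size P

size-mergeAt : ∀ {b} (_⊙_ : Formula → Formula → Formula) →
  (∀ F G → connectives (F ⊙ G) ≡ suc (connectives F + connectives G)) →
  ∀ a (P : Vec Formula (a + suc (suc b))) → size (mergeAt a _⊙_ P) ≡ suc (size P)
size-mergeAt _⊙_ ⊙-size zero    (F ∷ G ∷ P) =
  trans (cong (_+ size P) (⊙-size F G)) (cong suc (ℕₚ.+-assoc (connectives F) _ _))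
size-mergeAt _⊙_ ⊙-size (suc a) (F ∷ P)     =
  trans (cong (connectives F +_) (size-mergeAt _⊙_ ⊙-size a P)) (ℕₚ.+-suc _ _)

data PoolView : Vec Formula k → Set where
  literals    : ∀ {P : Vec Formula k} → VecAll.All Literal P → PoolView P
  disjunction : ∀ {b} a (P : Vec Formula (a + suc (suc b))) → PoolView (mergeAt a _∨_ P)
  conjunction : ∀ {b} a (P : Vec Formula (a + suc (suc b))) → PoolView (mergeAt a _∧_ P)

poolView-∷ : ∀ {x} {P : Vec Formula k} → Literal x → PoolView P → PoolView (x ∷ P)
poolView-∷ x-literal (literals P-literals) = literals (x-literal VecAll.∷ P-literals)
poolView-∷ _         (disjunction a P)    = disjunction (suc a) (_ ∷ P)
poolView-∷ _         (conjunction a P)    = conjunction (suc a) (_ ∷ P)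

poolView : ∀ (P : Vec Formula k) → PoolView P
poolView []            = literals VecAll.[]
poolView (pos n ∷ P)   = poolView-∷ (n , inj₁ refl) (poolView P)
poolView (neg n ∷ P)   = poolView-∷ (n , inj₂ refl) (poolView P)
poolView ((F ∧ G) ∷ P) = conjunction 0 (F ∷ G ∷ P)
poolView ((F ∨ G) ∷ P) = disjunction 0 (F ∷ G ∷ P)

binaryPool-unmerge : ∀ {b} (_⊙_ : Formula → Formula → Formula) →
  (∀ q F G → occ q (F ⊙ G) ≡ occ q F + occ q G) →
  ∀ a (P : Vec Formula (a + suc (suc b))) → BinaryPool (mergeAt a _⊙_ P) → BinaryPool P
binaryPool-unmerge _⊙_ ⊙-occ a P binary q = subst (_≤ 2) (occPool-mergeAt q _⊙_ (⊙-occ q) a P) (binary q)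

provable-by-size : ∀ n {P : Vec Formula k} {S} → PoolView P → size P ≡ n → BinaryPool P → Valid P S →
  CL5 k P S
provable-by-size _       (literals P-literals) _ binary valid = literal-provable _ _ P-literals binary valid
provable-by-size zero    (disjunction a P) size≡0 with () ← trans (sym size≡0) (size-mergeAt _∨_ (λ _ _ → refl) a P)
provable-by-size zero    (conjunction a P) size≡0 with () ← trans (sym size≡0) (size-mergeAt _∧_ (λ _ _ → refl) a P)
provable-by-size (suc n) {S = S} (disjunction a P) size≡ binary valid =
  subst (CL5 _ _) (mergeAt-splitOr a S)
    (orIntro a (provable-by-size n (poolView P) size′ binary′ (valid-splitOr a P valid)))
  where
  size′ : size P ≡ n
  size′ = ℕₚ.suc-injective (trans (sym (size-mergeAt _∨_ (λ _ _ → refl) a P)) size≡)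
  binary′ : BinaryPool P
  binary′ = binaryPool-unmerge _∨_ (λ _ _ _ → refl) a P binary
provable-by-size (suc n) {S = S} (conjunction a P) size≡ binary valid =
  subst (CL5 _ _) (mergeFGroups-splitAnd a S)
    (andIntro a (andBlocks⇒andCondition a (andBlocks-splitAnd a S))
      (provable-by-size n (poolView P) size′ binary′ (valid-splitAnd a P valid)))
  where
  size′ : size P ≡ n
  size′ = ℕₚ.suc-injective (trans (sym (size-mergeAt _∧_ (λ _ _ → refl) a P)) size≡)
  binary′ : BinaryPool P
  binary′ = binaryPool-unmerge _∧_ (λ _ _ _ → refl) a P binary

binaryTautology-provable : ∀ {P : Vec Formula k} {S} → BinaryPool P → Valid P S → CL5 k P S
binaryTautology-provable {P = P} = provable-by-size (size P) (poolView P) refl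

completeness : ∀ {P : Vec Formula k} {S} → InstanceOfBinaryTautology P S → CL5 k P S
completeness (P₀ , (binary , taut) , σ , refl) =
  subst-admissible σ (binaryTautology-provable binary (tautology⇒valid P₀ _ taut))

theorem7p5 : (k : ℕ) (P : Vec Formula k) (S : Structure k) →
    (CL5 k P S → InstanceOfBinaryTautology P S) ×
    (InstanceOfBinaryTautology P S → CL5 k P S)
theorem7p5 k P S = soundness , completeness
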